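{- Let $k\ge 2$ be an integer and $d\in(0,1)$. If $n\ge (2/d)^{2k-4}$ and $0<\rho\le (d/2)^{2k-4}$, then for every $n$-vertex $(\rho,d)$-dense graph $\Gamma$ and every coloring of the edges of $\Gamma$ with two colors, $\Gamma$ contains a monochromatic copy of $K_k$.
   Context: For constants $0<d,\rho\le 1$, an $n$-vertex graph $\Gamma$ is $(\rho,d)$-dense if every induced subgraph of $\Gamma$ on $m\ge \rho n$ vertices contains at least $d\,m^2/2$ edges.
   Formalization: The parameters d and ρ, both in the hypotheses and in the notion of a (ρ,d)-dense graph, are rational numbers. -}

module Defs where

open import Data.Nat as ℕ using (ℕ; zero; suc)
open import Data.Bool using (Bool; true; false; _∧_; if_then_else_)
open import Data.Fin using (Fin; _<_)
open import Data.Fin.Subset using (Subset; _∈_; ∣_∣)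
open import Data.Fin.Properties using (_<?_)
open import Data.List using (List; map; allFin)
open import Data.Nat.ListAction using (sum)
open import Data.Product using (Σ; _×_; ∃)
open import Data.Rational using (ℚ; _≤_; _*_; _/_; 1ℚ; ½)
import Data.Integer
open import Data.Vec using (lookup)
open import Relation.Binary.PropositionalEquality using (_≡_; _≢_)
open import Relation.Nullary.Decidable using (⌊_⌋)
open import Function.Definitions using (Injective)

_^ℚ_ : ℚ → ℕ → ℚ
p ^ℚ zero = 1ℚ
p ^ℚ suc m = p * (p ^ℚ m)

toℚ : ℕ → ℚ
toℚ m = Data.Integer.+ m / 1

record Graph (n : ℕ) : Set where
  field
    adj   : Fin n → Fin n → Bool
    sym   : ∀ i j → adj i j ≡ adj j i
    irrefl : ∀ i → adj i i ≡ false
open Graph public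

edgesIn : ∀ {n} → Graph n → Subset n → ℕ
edgesIn {n} G S =
  sum (map (λ i → sum (map (λ j →
        if ⌊ i <? j ⌋ ∧ lookup S i ∧ lookup S j ∧ adj G i j then 1 else 0)
      (allFin n))) (allFin n))

Dense : ∀ {n} → ℚ → ℚ → Graph n → Set
Dense {n} ρ d G = ∀ (S : Subset n) →
  ρ * toℚ n ≤ toℚ ∣ S ∣ →
  d * toℚ (∣ S ∣ ℕ.* ∣ S ∣) * ½ ≤ toℚ (edgesIn G S)

-- 2-colouring of the edges (given on all pairs, symmetric; only edges matter)
record Colouring {n} (G : Graph n) : Set where
  field
    col    : Fin n → Fin n → Fin 2
    colSym : ∀ i j → col i j ≡ col j i
open Colouring public

MonoClique : ∀ {n} {G : Graph n} → Colouring G → ℕ → Set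
MonoClique {n} {G} c k = Σ (Fin 2) λ colour → Σ (Fin k → Fin n) λ f →
  Injective _≡_ _≡_ f ×
  (∀ i j → i ≢ j → (adj G (f i) (f j) ≡ true) × (col c (f i) (f j) ≡ colour))

module Submission where

-- Erdős–Szekeres neighbourhood recursion, made to work in a dense graph. Write h = d/2. A set S of
-- m ≥ ρ n vertices spans at least h m² edges, so by double counting some v ∈ S has at least 2 h m
-- neighbours in S, and in one colour c at least h m of them. A colour-c clique in that
-- neighbourhood extends by v, so looking for (K_r, K_s) in S reduces to (K_(r-1), K_s) or
-- (K_r, K_(s-1)) in a set shrunk by at most the factor h. From (k, k) on all n vertices, the
-- recursion ends (r ≤ 1 or s ≤ 1, where a single vertex suffices) within 2k − 4 steps, so every
-- set where density is invoked has at least h^(2k−4) n ≥ ρ n vertices. The recursion itself runs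
-- over ℕ, after clearing the denominator of h.

open import Defs hiding (sym)
open import Data.Fin.Subset using (∣_∣)

module Combinatorial where

  open import Data.Nat.Base
  open import Data.Nat.Properties hiding (_<?_; <-cmp; <-asym; _≟_)
  open import Algebra.Properties.CommutativeSemigroup *-commutativeSemigroup using (x∙yz≈y∙xz)
  open import Algebra.Properties.Semiring.Sum +-*-semiring
    using (sum; sum-syntax; sum-cong-≗; ∑-distrib-+; ∑-comm; *-distribˡ-sum)
  open import Data.Bool.Base using (Bool; true; false; _∧_; if_then_else_)
  open import Data.Bool.Properties using (∧-conicalˡ; ∧-conicalʳ; T-≡)
  open import Data.Empty using (⊥-elim)
  open import Data.Fin.Base using (Fin; zero; suc)
  open import Data.Fin.Patterns using (0F; 1F)
  open import Data.Fin.Properties using (any?; _<?_; <-cmp; <-asym; _≟_)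
  open import Data.Fin.Subset using (Subset; _∈_; _⊆_; ∣_∣; ⊥; Nonempty)
  open import Data.Fin.Subset.Properties using (_∈?_; nonempty?; Empty-unique; ∣⊥∣≡0; ∣p∣≤∣x∷p∣; drop-there)
  open import Data.List.Base as List using (allFin)
  open import Data.List.Properties using (map-tabulate)
  import Data.Nat.ListAction as ListAction
  open import Data.Product using (∃; ∃₂; _×_; _,_; proj₁; proj₂)
  open import Data.Sum as Sum using (_⊎_; inj₁; inj₂)
  open import Data.Vec.Base using (lookup; _∷_; []; tabulate)
  open import Data.Vec.Properties using ([]=⇒lookup; lookup⇒[]=; lookup∘tabulate)
  open import Function.Base using (_∘_)
  open import Relation.Binary.PropositionalEquality
  open import Function.Bundles using (Equivalence)
  open import Function.Definitions using (Injective)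
  open import Relation.Binary.Definitions using (tri<; tri≈; tri>)
  open import Relation.Nullary.Decidable using (yes; no; _×-dec_; ⌊_⌋; toWitness)

  𝟙 : Bool → ℕ
  𝟙 b = if b then 1 else 0

  𝟙-∧ : ∀ a b → 𝟙 (a ∧ b) ≡ 𝟙 a * 𝟙 b
  𝟙-∧ true  b = sym (+-identityʳ (𝟙 b))
  𝟙-∧ false b = refl

  ∑-mono-≤ : ∀ {n} {f g : Fin n → ℕ} → (∀ i → f i ≤ g i) → sum f ≤ sum g
  ∑-mono-≤ {zero}  f≤g = z≤n
  ∑-mono-≤ {suc n} f≤g = +-mono-≤ (f≤g zero) (∑-mono-≤ (f≤g ∘ suc))

  ∑-mono-< : ∀ {n} {f g : Fin n → ℕ} → (∀ i → f i ≤ g i) → ∀ i → f i < g i → sum f < sum g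
  ∑-mono-< f≤g zero    fᵢ<gᵢ = +-mono-<-≤ fᵢ<gᵢ (∑-mono-≤ (f≤g ∘ suc))
  ∑-mono-< f≤g (suc i) fᵢ<gᵢ = +-mono-≤-< (f≤g zero) (∑-mono-< (f≤g ∘ suc) i fᵢ<gᵢ)

  sum-tabulate : ∀ {n} (f : Fin n → ℕ) → ListAction.sum (List.tabulate f) ≡ sum f
  sum-tabulate {zero}  f = refl
  sum-tabulate {suc n} f = cong (f zero +_) (sum-tabulate (f ∘ suc))

  sum-map-allFin : ∀ {n} (f : Fin n → ℕ) → ListAction.sum (List.map f (allFin n)) ≡ sum f
  sum-map-allFin f = trans (cong ListAction.sum (map-tabulate (λ i → i) f)) (sum-tabulate f)

  ∣p∣≡∑𝟙 : ∀ {n} (p : Subset n) → ∣ p ∣ ≡ ∑[ i < n ] 𝟙 (lookup p i)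
  ∣p∣≡∑𝟙 []          = refl
  ∣p∣≡∑𝟙 (true  ∷ p) = cong suc (∣p∣≡∑𝟙 p)
  ∣p∣≡∑𝟙 (false ∷ p) = ∣p∣≡∑𝟙 p

  ∑∈ : ∀ {n} → Subset n → (Fin n → ℕ) → ℕ
  ∑∈ {n} p f = ∑[ i < n ] (𝟙 (lookup p i) * f i)

  ∣tabulate∣≡∑𝟙 : ∀ {n} (f : Fin n → Bool) → ∣ tabulate f ∣ ≡ ∑[ i < n ] 𝟙 (f i)
  ∣tabulate∣≡∑𝟙 f = trans (∣p∣≡∑𝟙 (tabulate f)) (sum-cong-≗ (cong 𝟙 ∘ lookup∘tabulate f))

  ∑∈-const : ∀ {n} (p : Subset n) c → ∑∈ p (λ _ → c) ≡ c * ∣ p ∣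
  ∑∈-const {n} p c = begin
    ∑[ i < n ] (𝟙 (lookup p i) * c)  ≡⟨ sum-cong-≗ (λ i → *-comm (𝟙 (lookup p i)) c) ⟩
    ∑[ i < n ] (c * 𝟙 (lookup p i))  ≡⟨ *-distribˡ-sum c (𝟙 ∘ lookup p) ⟨
    c * ∑[ i < n ] 𝟙 (lookup p i)  ≡⟨ cong (c *_) (∣p∣≡∑𝟙 p) ⟨
    c * ∣ p ∣                      ∎
    where open ≡-Reasoning

  ∑∈-*ˡ : ∀ {n} (p : Subset n) c (f : Fin n → ℕ) → c * ∑∈ p f ≡ ∑∈ p (λ i → c * f i)
  ∑∈-*ˡ p c f = trans (*-distribˡ-sum c (λ i → 𝟙 (lookup p i) * f i))
                      (sum-cong-≗ (λ i → x∙yz≈y∙xz c (𝟙 (lookup p i)) (f i)))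

  nonempty⇒∣p∣>0 : ∀ {n} {p : Subset n} → Nonempty p → 0 < ∣ p ∣
  nonempty⇒∣p∣>0 {p = true ∷ p} (zero  , _)   = z<s
  nonempty⇒∣p∣>0 {p = x ∷ p}    (suc i , i∈p) = ≤-trans (nonempty⇒∣p∣>0 (i , drop-there i∈p)) (∣p∣≤∣x∷p∣ x p)

  ∣p∣>0⇒nonempty : ∀ {n} {p : Subset n} → 0 < ∣ p ∣ → Nonempty p
  ∣p∣>0⇒nonempty {n} {p} ∣p∣>0 with nonempty? p
  ... | yes nonempty = nonempty
  ... | no  empty    = ⊥-elim (<⇒≢ ∣p∣>0 (sym (trans (cong ∣_∣ (Empty-unique empty)) (∣⊥∣≡0 n))))

  ∑∈-≤⇒∃-≤ : ∀ {n} {p : Subset n} (f g : Fin n → ℕ) → Nonempty p →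
              ∑∈ p f ≤ ∑∈ p g → ∃ λ i → i ∈ p × f i ≤ g i
  ∑∈-≤⇒∃-≤ {p = p} f g (x , x∈p) ∑f≤∑g with any? (λ i → i ∈? p ×-dec f i ≤? g i)
  ... | yes found = found
  ... | no  none  = ⊥-elim (<⇒≱ (∑-mono-< g≤f x gₓ<fₓ) ∑f≤∑g)
    where
    g<f : ∀ {i} → i ∈ p → g i < f i
    g<f {i} i∈p = ≰⇒> (λ fᵢ≤gᵢ → none (i , i∈p , fᵢ≤gᵢ))
    g≤f : ∀ i → 𝟙 (lookup p i) * g i ≤ 𝟙 (lookup p i) * f i
    g≤f i with lookup p i in eq
    ... | true  = *-monoʳ-≤ 1 (<⇒≤ (g<f (lookup⇒[]= i p eq)))
    ... | false = z≤n
    gₓ<fₓ : 𝟙 (lookup p x) * g x < 𝟙 (lookup p x) * f x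
    gₓ<fₓ rewrite []=⇒lookup x∈p = *-monoʳ-< 1 (g<f x∈p)

  module _ {n} (R : Fin n → Fin n → Bool)
           (R-sym : ∀ i j → R i j ≡ R j i) (R-irrefl : ∀ i → R i i ≡ false) where

    𝟙-split-< : ∀ i j → 𝟙 (R i j) ≡ 𝟙 (⌊ i <? j ⌋ ∧ R i j) + 𝟙 (⌊ j <? i ⌋ ∧ R j i)
    𝟙-split-< i j with i <? j | j <? i
    ... | yes i<j | yes j<i = ⊥-elim (<-asym i<j j<i)
    ... | yes _   | no  _   = sym (+-identityʳ _)
    ... | no  _   | yes _   = cong 𝟙 (R-sym i j)
    ... | no  i≮j | no  j≮i with <-cmp i j
    ...   | tri< i<j _    _   = ⊥-elim (i≮j i<j)
    ...   | tri≈ _   refl _   = cong 𝟙 (R-irrefl i)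
    ...   | tri> _   _    j<i = ⊥-elim (j≮i j<i)

    double-counting : 2 * ∑[ i < n ] ∑[ j < n ] 𝟙 (⌊ i <? j ⌋ ∧ R i j) ≡ ∑[ i < n ] ∑[ j < n ] 𝟙 (R i j)
    double-counting = begin
      2 * E                                          ≡⟨ cong (E +_) (+-identityʳ E) ⟩
      E + E                                          ≡⟨ cong (E +_) (∑-comm (λ j i → 𝟙 (⌊ j <? i ⌋ ∧ R j i))) ⟩
      E + ∑[ i < n ] ∑[ j < n ] 𝟙 (⌊ j <? i ⌋ ∧ R j i) ≡⟨ ∑-distrib-+ (λ i → ∑[ j < n ] 𝟙 (⌊ i <? j ⌋ ∧ R i j)) _ ⟨
      ∑[ i < n ] (∑[ j < n ] 𝟙 (⌊ i <? j ⌋ ∧ R i j) + ∑[ j < n ] 𝟙 (⌊ j <? i ⌋ ∧ R j i))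
        ≡⟨ sum-cong-≗ (λ i → ∑-distrib-+ (λ j → 𝟙 (⌊ i <? j ⌋ ∧ R i j)) _) ⟨
      ∑[ i < n ] ∑[ j < n ] (𝟙 (⌊ i <? j ⌋ ∧ R i j) + 𝟙 (⌊ j <? i ⌋ ∧ R j i))
        ≡⟨ sum-cong-≗ (λ i → sum-cong-≗ (𝟙-split-< i)) ⟨
      ∑[ i < n ] ∑[ j < n ] 𝟙 (R i j)                ∎
      where
      open ≡-Reasoning
      E : ℕ
      E = ∑[ i < n ] ∑[ j < n ] 𝟙 (⌊ i <? j ⌋ ∧ R i j)

  2*≤+⇒≤⊎≤ : ∀ x y z → 2 * x ≤ y + z → x ≤ y ⊎ x ≤ z
  2*≤+⇒≤⊎≤ x y z 2x≤y+z with x ≤? y | x ≤? z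
  ... | yes x≤y | _       = inj₁ x≤y
  ... | no  _   | yes x≤z = inj₂ x≤z
  ... | no  x≰y | no  x≰z = ⊥-elim (<⇒≱ (+-mono-< (≰⇒> x≰y) (≰⇒> x≰z))
                                        (subst (_≤ y + z) (cong (x +_) (+-identityʳ x)) 2x≤y+z))

  *≤*⇒>0 : ∀ {a m} b t → 0 < a → 0 < m → a * m ≤ b * t → 0 < t
  *≤*⇒>0 {a} {m} b zero    0<a 0<m am≤b0 = ⊥-elim (<⇒≱ (*-mono-≤ 0<a 0<m) (subst (a * m ≤_) (*-zeroʳ b) am≤b0))
  *≤*⇒>0         b (suc t) _   _   _     = z<s

  module _ {j r s B : ℕ} (budget : j + (suc (suc r) + suc (suc s)) ≤ B + 4) where

    budget⇒≤ : j ≤ B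
    budget⇒≤ = +-cancelʳ-≤ 4 j B (≤-trans (+-monoʳ-≤ j 4≤) budget)
      where
      4≤ : 4 ≤ suc (suc r) + suc (suc s)
      4≤ = s≤s (s≤s (≤-trans (s≤s (s≤s z≤n)) (m≤n+m (suc (suc s)) r)))

    budget-stepˡ : suc j + (suc r + suc (suc s)) ≤ B + 4
    budget-stepˡ = subst (_≤ B + 4) (+-suc j _) budget

    budget-stepʳ : suc j + (suc (suc r) + suc s) ≤ B + 4
    budget-stepʳ = subst (_≤ B + 4) (trans (cong (λ t → j + suc (suc t)) (+-suc r (suc s))) (+-suc j _)) budget

  module _ {n} (G : Graph n) where

    degreeIn : Subset n → Fin n → ℕ
    degreeIn S v = ∑[ j < n ] 𝟙 (lookup S j ∧ adj G v j)

    handshake : ∀ S → 2 * edgesIn G S ≡ ∑∈ S (degreeIn S)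
    handshake S = begin
      2 * edgesIn G S                                  ≡⟨ cong (2 *_) edgesIn-∑ ⟩
      2 * ∑[ i < n ] ∑[ j < n ] 𝟙 (⌊ i <? j ⌋ ∧ E i j) ≡⟨ double-counting E E-sym E-irrefl ⟩
      ∑[ i < n ] ∑[ j < n ] 𝟙 (E i j)                  ≡⟨ sum-cong-≗ factor ⟩
      ∑∈ S (degreeIn S)                                ∎
      where
      open ≡-Reasoning
      E : Fin n → Fin n → Bool
      E i j = lookup S i ∧ (lookup S j ∧ adj G i j)
      E-sym : ∀ i j → E i j ≡ E j i
      E-sym i j with lookup S i | lookup S j
      ... | true  | true  = Graph.sym G i j
      ... | true  | false = refl
      ... | false | true  = refl
      ... | false | false = refl
      E-irrefl : ∀ i → E i i ≡ false
      E-irrefl i with lookup S i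
      ... | true  = irrefl G i
      ... | false = refl
      edgesIn-∑ : edgesIn G S ≡ ∑[ i < n ] ∑[ j < n ] 𝟙 (⌊ i <? j ⌋ ∧ E i j)
      edgesIn-∑ = trans (sum-map-allFin (λ i → ListAction.sum (List.map (λ j → 𝟙 (⌊ i <? j ⌋ ∧ E i j)) (allFin n))))
                        (sum-cong-≗ (λ i → sum-map-allFin (λ j → 𝟙 (⌊ i <? j ⌋ ∧ E i j))))
      factor : ∀ i → ∑[ j < n ] 𝟙 (E i j) ≡ 𝟙 (lookup S i) * degreeIn S i
      factor i = trans (sum-cong-≗ (λ j → 𝟙-∧ (lookup S i) (lookup S j ∧ adj G i j)))
                       (sym (*-distribˡ-sum (𝟙 (lookup S i)) (λ j → 𝟙 (lookup S j ∧ adj G i j))))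

    module _ (κ : Colouring G) where

      colourNbd : Subset n → Fin n → Fin 2 → Subset n
      colourNbd S v c = tabulate (λ j → lookup S j ∧ (adj G v j ∧ ⌊ col κ v j ≟ c ⌋))

      ∈-colourNbd⁻ : ∀ {S v c j} → j ∈ colourNbd S v c → j ∈ S × adj G v j ≡ true × col κ v j ≡ c
      ∈-colourNbd⁻ {S} {v} {c} {j} j∈N =
        lookup⇒[]= j S (∧-conicalˡ (lookup S j) _ N[j]) ,
        ∧-conicalˡ (adj G v j) _ adjacent∧coloured ,
        toWitness (Equivalence.from T-≡ (∧-conicalʳ (adj G v j) _ adjacent∧coloured))
        where
        N[j] : lookup S j ∧ (adj G v j ∧ ⌊ col κ v j ≟ c ⌋) ≡ true
        N[j] = trans (sym (lookup∘tabulate _ j)) ([]=⇒lookup j∈N)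
        adjacent∧coloured : adj G v j ∧ ⌊ col κ v j ≟ c ⌋ ≡ true
        adjacent∧coloured = ∧-conicalʳ (lookup S j) _ N[j]

      colourNbd⊆ : ∀ {S v c} → colourNbd S v c ⊆ S
      colourNbd⊆ j∈N with ∈-colourNbd⁻ j∈N
      ... | j∈S , _ = j∈S

      degreeIn-split : ∀ S v → degreeIn S v ≡ ∣ colourNbd S v 0F ∣ + ∣ colourNbd S v 1F ∣
      degreeIn-split S v = begin
        degreeIn S v                                           ≡⟨ sum-cong-≗ by-colour ⟩
        ∑[ j < n ] (𝟙 (N 0F j) + 𝟙 (N 1F j))                   ≡⟨ ∑-distrib-+ (𝟙 ∘ N 0F) (𝟙 ∘ N 1F) ⟩
        ∑[ j < n ] 𝟙 (N 0F j) + ∑[ j < n ] 𝟙 (N 1F j)          ≡⟨ cong₂ _+_ (∣tabulate∣≡∑𝟙 (N 0F)) (∣tabulate∣≡∑𝟙 (N 1F)) ⟨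
        ∣ colourNbd S v 0F ∣ + ∣ colourNbd S v 1F ∣            ∎
        where
        open ≡-Reasoning
        N : Fin 2 → Fin n → Bool
        N c j = lookup S j ∧ (adj G v j ∧ ⌊ col κ v j ≟ c ⌋)
        by-colour : ∀ j → 𝟙 (lookup S j ∧ adj G v j) ≡ 𝟙 (N 0F j) + 𝟙 (N 1F j)
        by-colour j with lookup S j | adj G v j | col κ v j
        ... | false | _     | _  = refl
        ... | true  | false | _  = refl
        ... | true  | true  | 0F = refl
        ... | true  | true  | 1F = refl

      rich-colourNbd : ∀ {S} a b → Nonempty S → a * (∣ S ∣ * ∣ S ∣) ≤ b * edgesIn G S →
                       ∃₂ λ v c → v ∈ S × a * ∣ S ∣ ≤ b * ∣ colourNbd S v c ∣
      rich-colourNbd {S} a b S≢∅ a∣S∣²≤be =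
        split-colours (∑∈-≤⇒∃-≤ (λ _ → 2 * (a * m)) (λ v → b * degreeIn S v) S≢∅ averaged)
        where
        m : ℕ
        m = ∣ S ∣
        split-colours : (∃ λ v → v ∈ S × 2 * (a * m) ≤ b * degreeIn S v) →
                        ∃₂ λ v c → v ∈ S × a * m ≤ b * ∣ colourNbd S v c ∣
        split-colours (v , v∈S , 2am≤b·deg)
          with 2*≤+⇒≤⊎≤ (a * m) (b * ∣ colourNbd S v 0F ∣) (b * ∣ colourNbd S v 1F ∣)
                 (subst (2 * (a * m) ≤_) (trans (cong (b *_) (degreeIn-split S v)) (*-distribˡ-+ b _ _)) 2am≤b·deg)
        ... | inj₁ am≤bN₀ = v , 0F , v∈S , am≤bN₀
        ... | inj₂ am≤bN₁ = v , 1F , v∈S , am≤bN₁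
        averaged : ∑∈ S (λ _ → 2 * (a * m)) ≤ ∑∈ S (λ v → b * degreeIn S v)
        averaged = begin
          ∑∈ S (λ _ → 2 * (a * m))       ≡⟨ ∑∈-const S (2 * (a * m)) ⟩
          2 * (a * m) * m                ≡⟨ trans (*-assoc 2 (a * m) m) (cong (2 *_) (*-assoc a m m)) ⟩
          2 * (a * (m * m))              ≤⟨ *-monoʳ-≤ 2 a∣S∣²≤be ⟩
          2 * (b * edgesIn G S)          ≡⟨ x∙yz≈y∙xz 2 b (edgesIn G S) ⟩
          b * (2 * edgesIn G S)          ≡⟨ cong (b *_) (handshake S) ⟩
          b * ∑∈ S (degreeIn S)          ≡⟨ ∑∈-*ˡ S b (degreeIn S) ⟩
          ∑∈ S (λ v → b * degreeIn S v)  ∎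
          where open ≤-Reasoning

      record MonoCliqueIn (S : Subset n) (c : Fin 2) (r : ℕ) : Set where
        field
          vertex        : Fin r → Fin n
          injective     : Injective _≡_ _≡_ vertex
          inside        : ∀ i → vertex i ∈ S
          monochromatic : ∀ i j → i ≢ j → adj G (vertex i) (vertex j) ≡ true × col κ (vertex i) (vertex j) ≡ c
      open MonoCliqueIn

      toMonoClique : ∀ {S c r} → MonoCliqueIn S c r → MonoClique κ r
      toMonoClique {c = c} K = c , vertex K , injective K , monochromatic K

      empty-clique : ∀ {S c} → MonoCliqueIn S c 0
      empty-clique .vertex ()
      empty-clique .injective {()}
      empty-clique .inside ()
      empty-clique .monochromatic ()

      singleton-clique : ∀ {S c v} → v ∈ S → MonoCliqueIn S c 1
      singleton-clique {v = v} v∈S .vertex _ = v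
      singleton-clique v∈S .injective {0F} {0F} _ = refl
      singleton-clique v∈S .inside _ = v∈S
      singleton-clique v∈S .monochromatic 0F 0F 0≢0 = ⊥-elim (0≢0 refl)

      clique-⊆ : ∀ {S T c r} → S ⊆ T → MonoCliqueIn S c r → MonoCliqueIn T c r
      clique-⊆ S⊆T K = record
        { vertex = vertex K ; injective = injective K ; inside = S⊆T ∘ inside K ; monochromatic = monochromatic K }

      clique-cone : ∀ {S v c r} → v ∈ S → MonoCliqueIn (colourNbd S v c) c r → MonoCliqueIn S c (suc r)
      clique-cone {S} {v} {c} {r} v∈S K = record
        { vertex = vertex′ ; injective = injective′ ; inside = inside′ ; monochromatic = monochromatic′ }
        where
        joined : ∀ i → adj G v (vertex K i) ≡ true × col κ v (vertex K i) ≡ c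
        joined i with ∈-colourNbd⁻ {S} (inside K i)
        ... | _ , adjacent , coloured = adjacent , coloured
        v∉K : ∀ i → v ≢ vertex K i
        v∉K i v≡w with trans (sym (irrefl G v)) (subst (λ w → adj G v w ≡ true) (sym v≡w) (proj₁ (joined i)))
        ... | ()
        vertex′ : Fin (suc r) → Fin n
        vertex′ zero    = v
        vertex′ (suc i) = vertex K i
        injective′ : Injective _≡_ _≡_ vertex′
        injective′ {zero}  {zero}  _   = refl
        injective′ {zero}  {suc j} v≡w = ⊥-elim (v∉K j v≡w)
        injective′ {suc i} {zero}  w≡v = ⊥-elim (v∉K i (sym w≡v))
        injective′ {suc i} {suc j} eq  = cong suc (injective K eq)
        inside′ : ∀ i → vertex′ i ∈ S
        inside′ zero    = v∈S
        inside′ (suc i) = colourNbd⊆ {S} (inside K i)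
        monochromatic′ : ∀ i j → i ≢ j → adj G (vertex′ i) (vertex′ j) ≡ true × col κ (vertex′ i) (vertex′ j) ≡ c
        monochromatic′ zero    zero    0≢0 = ⊥-elim (0≢0 refl)
        monochromatic′ zero    (suc j) _   = joined j
        monochromatic′ (suc i) zero    _   =
          trans (Graph.sym G _ v) (proj₁ (joined i)) , trans (colSym κ _ v) (proj₂ (joined i))
        monochromatic′ (suc i) (suc j) i≢j = monochromatic K i j (i≢j ∘ cong suc)

      -- Large j S bounds |S| from below after j recursion steps. The budget j + (r + s) ≤ J + 4
      -- guarantees j ≤ J at every step that needs density, i.e. whenever r, s ≥ 2.
      module _ (a b J : ℕ) (0<a : 0 < a) (Large : ℕ → Subset n → Set)
               (dense : ∀ {j S} → j ≤ J → Large j S → a * (∣ S ∣ * ∣ S ∣) ≤ b * edgesIn G S)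
               (grow : ∀ {j S T} → Large j S → a * ∣ S ∣ ≤ b * ∣ T ∣ → Large (suc j) T) where

        colourNbd≢∅ : ∀ {S v c} → Nonempty S → a * ∣ S ∣ ≤ b * ∣ colourNbd S v c ∣ → Nonempty (colourNbd S v c)
        colourNbd≢∅ S≢∅ rich = ∣p∣>0⇒nonempty (*≤*⇒>0 b _ 0<a (nonempty⇒∣p∣>0 S≢∅) rich)

        Arrows : ℕ → ℕ → ℕ → Set
        Arrows r s j = ∀ {S} → Nonempty S → Large j S → j + (r + s) ≤ J + 4 →
                         MonoCliqueIn S 0F r ⊎ MonoCliqueIn S 1F s

        large⇒mono-clique : ∀ r s {j} → Arrows r s j
        large⇒mono-clique 0             _             _         _ _ = inj₁ empty-clique
        large⇒mono-clique 1             _             (_ , v∈S) _ _ = inj₁ (singleton-clique v∈S)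
        large⇒mono-clique (suc (suc r)) 0             _         _ _ = inj₂ empty-clique
        large⇒mono-clique (suc (suc r)) 1             (_ , v∈S) _ _ = inj₂ (singleton-clique v∈S)
        large⇒mono-clique (suc (suc r)) (suc (suc s)) {j} {S} S≢∅ large budget =
          descend (large⇒mono-clique (suc r) (suc (suc s))) (large⇒mono-clique (suc (suc r)) (suc s))
                  (rich-colourNbd a b S≢∅ (dense (budget⇒≤ budget) large))
          where
          descend : Arrows (suc r) (suc (suc s)) (suc j) → Arrows (suc (suc r)) (suc s) (suc j) →
                    (∃₂ λ v c → v ∈ S × a * ∣ S ∣ ≤ b * ∣ colourNbd S v c ∣) →
                    MonoCliqueIn S 0F (suc (suc r)) ⊎ MonoCliqueIn S 1F (suc (suc s))
          descend red _ (v , 0F , v∈S , rich) =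
            Sum.map (clique-cone v∈S) (clique-⊆ colourNbd⊆)
              (red (colourNbd≢∅ S≢∅ rich) (grow large rich) (budget-stepˡ budget))
          descend _ blue (v , 1F , v∈S , rich) =
            Sum.map (clique-⊆ colourNbd⊆) (clique-cone v∈S)
              (blue (colourNbd≢∅ S≢∅ rich) (grow large rich) (budget-stepʳ budget))

module Rational where

  open import Data.Empty using (⊥-elim)
  open import Data.Fin.Base using (zero)
  open import Data.Fin.Patterns using (0F; 1F)
  open import Data.Fin.Subset using (Subset; ∣_∣; ⊤; Nonempty)
  open import Data.Fin.Subset.Properties using (∣⊤∣≡n; ∈⊤)
  open import Data.Integer.Base as ℤ using (+_; +[1+_])
  import Data.Integer.Properties as ℤ
  open import Data.Nat.Base as ℕ using (ℕ; zero; suc; z<s)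
  import Data.Nat.Properties as ℕ
  open import Data.Product using (_,_)
  open import Data.Rational.Base hiding (∣_∣)
  open import Data.Rational.Properties
  open import Data.Rational.Unnormalised.Base as ℚᵘ using (mkℚᵘ)
    renaming (_≃_ to _≃ᵘ_; _≤_ to _≤ᵘ_; _*_ to _*ᵘ_)
  import Data.Rational.Unnormalised.Properties as ℚᵘ
  open import Data.Sum using (_⊎_)
  open import Function.Bundles using (Equivalence; _⇔_; mk⇔)
  open import Relation.Binary.PropositionalEquality using (_≡_; refl; sym; trans; cong; subst₂)
  open Combinatorial using (MonoCliqueIn; large⇒mono-clique)

  ∣↥∣>0 : ∀ q .{{_ : Positive q}} → 0 ℕ.< ℤ.∣ ↥ q ∣
  ∣↥∣>0 (mkℚ +[1+ _ ] _ _) = z<s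

  toℚᵘ-toℚ : ∀ x → toℚᵘ (toℚ x) ≃ᵘ mkℚᵘ (+ x) 0
  toℚᵘ-toℚ x = toℚᵘ-fromℚᵘ (mkℚᵘ (+ x) 0)

  *toℚ≤toℚ⇔ : ∀ q .{{_ : NonNegative q}} x y → q * toℚ x ≤ toℚ y ⇔ ℤ.∣ ↥ q ∣ ℕ.* x ℕ.≤ ↧ₙ q ℕ.* y
  *toℚ≤toℚ⇔ q@(mkℚ (+ a) b-1 _) x y = mk⇔
    (λ qx≤y → unnormalised⇒ (ℚᵘ.≤-respʳ-≃ (toℚᵘ-toℚ y) (ℚᵘ.≤-respˡ-≃ lhs (toℚᵘ-mono-≤ qx≤y))))
    (λ ax≤by → toℚᵘ-cancel-≤ (ℚᵘ.≤-respʳ-≃ (ℚᵘ.≃-sym (toℚᵘ-toℚ y))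
                                (ℚᵘ.≤-respˡ-≃ (ℚᵘ.≃-sym lhs) (⇒unnormalised ax≤by))))
    where
    lhs : toℚᵘ (q * toℚ x) ≃ᵘ mkℚᵘ (+ a) b-1 *ᵘ mkℚᵘ (+ x) 0
    lhs = ℚᵘ.≃-trans (toℚᵘ-homo-* q (toℚ x)) (ℚᵘ.*-congˡ {toℚᵘ q} (toℚᵘ-toℚ x))
    numerator : ℚᵘ.↥ (mkℚᵘ (+ a) b-1 *ᵘ mkℚᵘ (+ x) 0) ℤ.* + 1 ≡ + (a ℕ.* x)
    numerator = trans (ℤ.*-identityʳ _) (sym (ℤ.pos-* a x))
    denominator : + y ℤ.* ℚᵘ.↧ (mkℚᵘ (+ a) b-1 *ᵘ mkℚᵘ (+ x) 0) ≡ + (suc b-1 ℕ.* y)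
    denominator = trans (sym (ℤ.pos-* y _))
                        (cong +_ (trans (cong (λ t → y ℕ.* suc t) (ℕ.*-identityʳ b-1)) (ℕ.*-comm y (suc b-1))))
    unnormalised⇒ : mkℚᵘ (+ a) b-1 *ᵘ mkℚᵘ (+ x) 0 ≤ᵘ mkℚᵘ (+ y) 0 → a ℕ.* x ℕ.≤ suc b-1 ℕ.* y
    unnormalised⇒ (ℚᵘ.*≤* le) = ℤ.drop‿+≤+ (subst₂ ℤ._≤_ numerator denominator le)
    ⇒unnormalised : a ℕ.* x ℕ.≤ suc b-1 ℕ.* y → mkℚᵘ (+ a) b-1 *ᵘ mkℚᵘ (+ x) 0 ≤ᵘ mkℚᵘ (+ y) 0
    ⇒unnormalised le = ℚᵘ.*≤* (subst₂ ℤ._≤_ (sym numerator) (sym denominator) (ℤ.+≤+ le))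

  ^ℚ-nonNeg : ∀ p .{{_ : NonNegative p}} j → NonNegative (p ^ℚ j)
  ^ℚ-nonNeg p zero    = _
  ^ℚ-nonNeg p (suc j) = nonNeg*nonNeg⇒nonNeg p (p ^ℚ j) {{^ℚ-nonNeg p j}}

  ^ℚ-pos : ∀ p .{{_ : Positive p}} j → Positive (p ^ℚ j)
  ^ℚ-pos p zero    = _
  ^ℚ-pos p (suc j) = pos*pos⇒pos p (p ^ℚ j) {{^ℚ-pos p j}}

  ^ℚ-antitone : ∀ {p} .{{_ : NonNegative p}} → p ≤ 1ℚ → ∀ {i j} → i ℕ.≤ j → p ^ℚ j ≤ p ^ℚ i
  ^ℚ-antitone {p} p≤1 i≤j = go (ℕ.≤⇒≤′ i≤j)
    where
    go : ∀ {i j} → i ℕ.≤′ j → p ^ℚ j ≤ p ^ℚ i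
    go ℕ.≤′-refl              = ≤-refl
    go (ℕ.≤′-step {j} i≤′j) = ≤-trans (*-monoʳ-≤-nonNeg (p ^ℚ j) {{^ℚ-nonNeg p j}} p≤1)
                                       (≤-trans (≤-reflexive (*-identityˡ (p ^ℚ j))) (go i≤′j))

  pos≤toℚ⇒>0 : ∀ {q n} .{{_ : Positive q}} → q ≤ toℚ n → 0 ℕ.< n
  pos≤toℚ⇒>0 {q} {zero}  q≤0 = ⊥-elim (<-irrefl refl (<-≤-trans (positive⁻¹ q) q≤0))
  pos≤toℚ⇒>0 {n = suc n} _   = z<s

  module _ {n} (G : Graph n) (κ : Colouring G) {h ρ : ℚ} .{{_ : Positive h}} (h≤1 : h ≤ 1ℚ)
           {J : ℕ} (ρ≤hᴶ : ρ ≤ h ^ℚ J)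
           (dense : ∀ S → ρ * toℚ n ≤ toℚ ∣ S ∣ → h * toℚ (∣ S ∣ ℕ.* ∣ S ∣) ≤ toℚ (edgesIn G S)) where

    private instance
      h-nonNeg : NonNegative h
      h-nonNeg = pos⇒nonNeg h

    Large : ℕ → Subset n → Set
    Large j S = h ^ℚ j * toℚ n ≤ toℚ ∣ S ∣

    large-dense : ∀ {j S} → j ℕ.≤ J → Large j S →
                  ℤ.∣ ↥ h ∣ ℕ.* (∣ S ∣ ℕ.* ∣ S ∣) ℕ.≤ ↧ₙ h ℕ.* edgesIn G S
    large-dense {j} {S} j≤J large =
      Equivalence.to (*toℚ≤toℚ⇔ h (∣ S ∣ ℕ.* ∣ S ∣) (edgesIn G S)) (dense S ρn≤∣S∣)
      where
      ρn≤∣S∣ : ρ * toℚ n ≤ toℚ ∣ S ∣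
      ρn≤∣S∣ = ≤-trans (*-monoʳ-≤-nonNeg (toℚ n) {{normalize-nonNeg n 1}} (≤-trans ρ≤hᴶ (^ℚ-antitone h≤1 j≤J)))
                       large

    large-grow : ∀ {j S T} → Large j S → ℤ.∣ ↥ h ∣ ℕ.* ∣ S ∣ ℕ.≤ ↧ₙ h ℕ.* ∣ T ∣ → Large (suc j) T
    large-grow {j} {S} {T} large rich =
      ≤-trans (≤-reflexive (*-assoc h (h ^ℚ j) (toℚ n)))
              (≤-trans (*-monoˡ-≤-nonNeg h large) (Equivalence.from (*toℚ≤toℚ⇔ h ∣ S ∣ ∣ T ∣) rich))

    dense⇒mono-clique : 0 ℕ.< n → ∀ r s → r ℕ.+ s ℕ.≤ J ℕ.+ 4 →
                            MonoCliqueIn G κ ⊤ 0F r ⊎ MonoCliqueIn G κ ⊤ 1F s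
    dense⇒mono-clique 0<n r s budget =
      large⇒mono-clique G κ (ℤ.∣ ↥ h ∣) (↧ₙ h) J (∣↥∣>0 h) Large (λ {j} {S} → large-dense {j} {S})
             (λ {j} {S} {T} → large-grow {j} {S} {T}) r s {0} {⊤} (⊤-nonempty 0<n) large-⊤ budget
      where
      ⊤-nonempty : ∀ {m} → 0 ℕ.< m → Nonempty (⊤ {m})
      ⊤-nonempty {suc m} _ = zero , ∈⊤
      large-⊤ : Large 0 ⊤
      large-⊤ = ≤-reflexive (trans (*-identityˡ (toℚ n)) (cong toℚ (sym (∣⊤∣≡n n))))

open import Data.Nat as ℕ using (ℕ)
open import Data.Rational using (ℚ; _≤_; _<_; _÷_; 0ℚ; 1ℚ; _*_; _+_; ½; positive)
open import Data.Rational.Properties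
  using (pos⇒nonZero; pos*pos⇒pos; 1/pos⇒pos; *-monoʳ-≤-nonNeg; <⇒≤; ≤-trans; *-assoc; *-comm)
open import Data.Rational.Base using (Positive; *≤*; 1/_)
import Data.Integer.Base as ℤ
import Data.Nat.Properties as ℕ
open import Data.Sum using ([_,_]′)
open import Relation.Binary.PropositionalEquality using (_≡_; cong; subst; sym; trans)
open Combinatorial using (toMonoClique)
open Rational using (dense⇒mono-clique; ^ℚ-pos; pos≤toℚ⇒>0)

proposition3p1 : (k : ℕ) → 2 ℕ.≤ k → (d : ℚ) → (d0 : 0ℚ < d) → d < 1ℚ →
    (n : ℕ) → (ρ : ℚ) →
    (_÷_ (1ℚ + 1ℚ) d {{pos⇒nonZero d {{positive d0}}}}) ^ℚ (2 ℕ.* k ℕ.∸ 4) ≤ toℚ n →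
    0ℚ < ρ → ρ ≤ (d * ½) ^ℚ (2 ℕ.* k ℕ.∸ 4) →
    (G : Graph n) → Dense ρ d G → (c : Colouring G) → MonoClique c k
proposition3p1 k 2≤k d 0<d d<1 n ρ n-large _ ρ-small G D κ =
  [ toMonoClique G κ , toMonoClique G κ ]′ (dense⇒mono-clique G κ h≤1 ρ-small dense 0<n k k budget)
  where
  instance
    d-pos : Positive d
    d-pos = positive 0<d
    h-pos : Positive (d * ½)
    h-pos = pos*pos⇒pos d ½
  h≤1 : d * ½ ≤ 1ℚ
  h≤1 = ≤-trans (*-monoʳ-≤-nonNeg ½ (<⇒≤ d<1)) (*≤* (ℤ.+≤+ (ℕ.s≤s ℕ.z≤n)))
  dense : ∀ S → ρ * toℚ n ≤ toℚ ∣ S ∣ → d * ½ * toℚ (∣ S ∣ ℕ.* ∣ S ∣) ≤ toℚ (edgesIn G S)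
  dense S large = subst (_≤ toℚ (edgesIn G S)) d·m²·½≡h·m² (D S large)
    where
    m² : ℚ
    m² = toℚ (∣ S ∣ ℕ.* ∣ S ∣)
    d·m²·½≡h·m² : d * m² * ½ ≡ d * ½ * m²
    d·m²·½≡h·m² = trans (*-assoc d m² ½) (trans (cong (d *_) (*-comm m² ½)) (sym (*-assoc d ½ m²)))
  2/d-pos : Positive (_÷_ (1ℚ + 1ℚ) d {{pos⇒nonZero d}})
  2/d-pos = pos*pos⇒pos (1ℚ + 1ℚ) ((1/ d) {{pos⇒nonZero d}}) {{1/pos⇒pos d}}
  0<n : 0 ℕ.< n
  0<n = pos≤toℚ⇒>0 {{^ℚ-pos _ {{2/d-pos}} (2 ℕ.* k ℕ.∸ 4)}} n-large
  budget : k ℕ.+ k ℕ.≤ (2 ℕ.* k ℕ.∸ 4) ℕ.+ 4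
  budget = ℕ.≤-reflexive (sym (trans (ℕ.m∸n+n≡m (ℕ.+-mono-≤ 2≤k (ℕ.+-mono-≤ 2≤k ℕ.z≤n)))
                                     (cong (k ℕ.+_) (ℕ.+-identityʳ k))))
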